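{- Weak superdevelopments are finite: for every initially labeled term $A$ there is no infinite sequence $A = A_0 \to_w A_1 \to_w A_2 \to_w \cdots$.
   Context: Labeled terms: $A ::= x \mid \lambda^a x.A \mid A\,@^a A$ with labels $a$ from a countably infinite set containing a distinguished never-bound label $\star$; in $A\,@^a B$ the label $a$ binds the occurrences of $a$ in $A$. Terms are up to renaming of bound variables and labels; $A[x:=B]$ is substitution capturing neither variables nor labels; $A[a:=\star]$ replaces free occurrences of label $a$ by $\star$. For a context $C$, $\mathrm{bPath}(C)$ is the sequence of variables bound above the hole; a term is away from a sequence $S$ if none of its free variables occur in $S$. $C[(\lambda^a x.A)\,@^a B]\to_S C[A[a:=\star][x:=B]]$ whenever $(\lambda^a x.A)\,@^a B$ is away from $\mathrm{bPath}(C)\oplus S$; $\to_w$ is $\to_S$ with $S$ empty. A labeled term is initially labeled iff all its abstractions carry distinct labels. -}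

module Defs where

open import Data.Nat using (ℕ; zero; suc; _+_; _∸_; _<_; _≤_; _<ᵇ_; _≡ᵇ_)
open import Data.Bool using (Bool; true; false; if_then_else_)
open import Data.List using (List; []; _∷_; _++_; length)
open import Data.Product using (Σ; _×_)
open import Relation.Nullary using (¬_)
open import Relation.Binary.PropositionalEquality using (_≡_)
open import Data.List.Relation.Unary.Unique.Propositional using (Unique)

-- Labeled terms, up to renaming of bound variables and bound labels,
-- represented with de Bruijn indices for BOTH variables and labels.
--
-- * Variables: 'var i' is a de Bruijn index; indices beyond the number
--   of enclosing λ's denote free variables.
-- * Labels: in  A @^a B  the label a is a binder whose scope is A.
--   Hence an application node carries no label data (its label is the
--   binder), and the label of an abstraction is either the distinguished
--   never-bound label ⋆ ('star') or a de Bruijn index 'lbl i' counting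
--   the enclosing applications in whose FUNCTION part we are; indices
--   beyond that count denote free labels.

data Lab : Set where
  star : Lab
  lbl  : ℕ → Lab

data Tm : Set where
  var : ℕ → Tm
  lam : Lab → Tm → Tm
  app : Tm → Tm → Tm

vshift : ℕ → Tm → Tm
vshift c (var i) = if i <ᵇ c then var i else var (suc i)
vshift c (lam l A) = lam l (vshift (suc c) A)
vshift c (app A B) = app (vshift c A) (vshift c B)

lshiftLab : ℕ → Lab → Lab
lshiftLab c star = star
lshiftLab c (lbl i) = if i <ᵇ c then lbl i else lbl (suc i)

lshift : ℕ → Tm → Tm
lshift c (var i) = var i
lshift c (lam l A) = lam (lshiftLab c l) (lshift c A)
lshift c (app A B) = app (lshift (suc c) A) (lshift c B)

-- A[a := ⋆] where a is the label bound at index c (the binder is removed)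
lstarLab : ℕ → Lab → Lab
lstarLab c star = star
lstarLab c (lbl i) =
  if i <ᵇ c then lbl i else (if i ≡ᵇ c then star else lbl (i ∸ 1))

lstar : ℕ → Tm → Tm
lstar c (var i) = var i
lstar c (lam l A) = lam (lstarLab c l) (lstar c A)
lstar c (app A B) = app (lstar (suc c) A) (lstar c B)

-- A[x := B] where x is the variable bound at index j (the binder is
-- removed); capture-avoiding for variables AND labels
subst : ℕ → Tm → Tm → Tm
subst j B (var i) =
  if i <ᵇ j then var i else (if i ≡ᵇ j then B else var (i ∸ 1))
subst j B (lam l A) = lam l (subst (suc j) (vshift 0 B) A)
subst j B (app A₁ A₂) = app (subst j (lshift 0 B) A₁) (subst j B A₂)

-- contractum of (λ^a x.A) @^a B :  A[a:=⋆][x:=B]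
contract : Tm → Tm → Tm
contract A B = subst 0 B (lstar 0 A)

data Occ : ℕ → Tm → Set where
  occ-var  : ∀ {i} → Occ i (var i)
  occ-lam  : ∀ {i l A} → Occ (suc i) A → Occ i (lam l A)
  occ-appl : ∀ {i A B} → Occ i A → Occ i (app A B)
  occ-appr : ∀ {i A B} → Occ i B → Occ i (app A B)

-- Under k variable binders (bPath(C) = the k bound variables, S empty),
-- t is away from bPath(C) iff none of the indices 0..k-1 occurs free in t.
AwayFrom : ℕ → Tm → Set
AwayFrom k t = ∀ i → i < k → ¬ Occ i t

-- Weak reduction →_w : contraction of a redex (λ^a x.A) @^a B in any
-- context C, provided the redex is away from bPath(C).
-- In the de Bruijn representation the abstraction's label being the
-- label bound by the application means it is 'lbl 0'.
-- k = number of variables bound above the hole.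

data StepW (k : ℕ) : Tm → Tm → Set where
  β     : ∀ {A B} → AwayFrom k (app (lam (lbl 0) A) B) →
          StepW k (app (lam (lbl 0) A) B) (contract A B)
  ξ-lam : ∀ {l A A'} → StepW (suc k) A A' → StepW k (lam l A) (lam l A')
  ξ-appl : ∀ {A A' B} → StepW k A A' → StepW k (app A B) (app A' B)
  ξ-appr : ∀ {A B B'} → StepW k B B' → StepW k (app A B) (app A B')

_⟶w_ : Tm → Tm → Set
A ⟶w B = StepW 0 A B

-- Initially labeled: all abstractions carry distinct labels.
-- Each abstraction label is resolved to its identity: ⋆, a free label
-- (by name), or the particular application node binding it (by its
-- position in the term).

data Dir : Set where
  dLam dAppL dAppR : Dir

data LabId : Set where
  starId  : LabId
  freeId  : ℕ → LabId
  boundId : List Dir → LabId     -- reversed path from root to binder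

resolve : List (List Dir) → Lab → LabId
resolve ctx star = starId
resolve [] (lbl i) = freeId i
resolve (p ∷ ctx) (lbl zero) = boundId p
resolve (p ∷ ctx) (lbl (suc i)) = resolve ctx (lbl i)

-- ctx: positions of enclosing label binders (innermost first);
-- p: reversed path of the current subterm
absLabels : List (List Dir) → List Dir → Tm → List LabId
absLabels ctx p (var i) = []
absLabels ctx p (lam l A) = resolve ctx l ∷ absLabels ctx (dLam ∷ p) A
absLabels ctx p (app A B) =
  absLabels (p ∷ ctx) (dAppL ∷ p) A ++ absLabels ctx (dAppR ∷ p) B

InitiallyLabeled : Tm → Set
InitiallyLabeled A = Unique (absLabels [] [] A)

InfiniteWSeq : Tm → Set
InfiniteWSeq A = Σ (ℕ → Tm) λ f → (f 0 ≡ A) × (∀ n → f n ⟶w f (suc n))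

-- Given weights for
-- the free variables and free labels, a variable weighs what its
-- environment says, λ^a x.A gives x the weight of its label a (⋆ weighs 0),
-- and A @^a B weighs A with a assigned the weight w of B, plus w + 1.
-- Weights are monotone in the environments, and substituting B for x
-- amounts to assigning x the weight of B, while relabelling to ⋆ can only
-- lower weights. So the contractum of (λ^a x.A) @^a B, with w the weight
-- of B, weighs at most A with both x and a assigned w, whereas the redex
-- weighs exactly that plus w + 1. Hence every step lowers the weight, and
-- there is no infinite reduction.
module Submission where

open import Defs
open import Data.Bool using (true; false; if_then_else_)
open import Data.Bool.Properties using (if-float)
open import Data.Nat using (ℕ; zero; suc; _+_; _∸_; _<_; _≤_; _<ᵇ_; _≡ᵇ_; z≤n; s≤s)
open import Data.Nat.Induction using (<-wellFounded)
open import Data.Nat.Properties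
  using (≤-refl; ≤-trans; <⇒≤; ≤-<-trans; m<m+n; +-mono-≤; +-monoˡ-<; +-mono-≤-<)
open import Data.Product using (_,_)
open import Function using (_∘_; _on_)
open import Induction.InfiniteDescent using (Descent; descent∧wf⇒empty)
open import Relation.Binary.Construct.On as On using ()
open import Relation.Binary.PropositionalEquality using (_≡_; refl; trans; cong)
open import Relation.Nullary using (¬_)

Env : Set
Env = ℕ → ℕ

_∷ₑ_ : ℕ → Env → Env
(w ∷ₑ ρ) zero = w
(w ∷ₑ ρ) (suc i) = ρ i

insert : ℕ → ℕ → Env → Env
insert zero w ρ = w ∷ₑ ρ
insert (suc c) w ρ = ρ 0 ∷ₑ insert c w (ρ ∘ suc)

insert-lookup : ∀ c w ρ i →
  insert c w ρ i ≡ (if i <ᵇ c then ρ i else (if i ≡ᵇ c then w else ρ (i ∸ 1)))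
insert-lookup zero w ρ zero = refl
insert-lookup zero w ρ (suc i) = refl
insert-lookup (suc c) w ρ zero = refl
insert-lookup (suc zero) w ρ (suc zero) = refl
insert-lookup (suc (suc c)) w ρ (suc zero) = refl
insert-lookup (suc c) w ρ (suc (suc i)) = insert-lookup c w (ρ ∘ suc) (suc i)

insert-lookup-shifted : ∀ c w ρ i →
  (if i <ᵇ c then insert c w ρ i else insert c w ρ (suc i)) ≡ ρ i
insert-lookup-shifted zero w ρ i = refl
insert-lookup-shifted (suc c) w ρ zero = refl
insert-lookup-shifted (suc c) w ρ (suc i) = insert-lookup-shifted c w (ρ ∘ suc) i

_≤ₑ_ : Env → Env → Set
ρ ≤ₑ ρ' = ∀ i → ρ i ≤ ρ' i

≤ₑ-refl : ∀ {ρ} → ρ ≤ₑ ρ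
≤ₑ-refl _ = ≤-refl

∷ₑ-mono : ∀ {v v' ρ ρ'} → v ≤ v' → ρ ≤ₑ ρ' → (v ∷ₑ ρ) ≤ₑ (v' ∷ₑ ρ')
∷ₑ-mono v≤v' ρ≤ρ' zero = v≤v'
∷ₑ-mono v≤v' ρ≤ρ' (suc i) = ρ≤ρ' i

labelWeight : Env → Lab → ℕ
labelWeight σ star = 0
labelWeight σ (lbl i) = σ i

weight : Tm → Env → Env → ℕ
weight (var i) ρ σ = ρ i
weight (lam l A) ρ σ = weight A (labelWeight σ l ∷ₑ ρ) σ
weight (app A B) ρ σ = weight A ρ (weight B ρ σ ∷ₑ σ) + suc (weight B ρ σ)

labelWeight-mono : ∀ {σ σ'} l → σ ≤ₑ σ' → labelWeight σ l ≤ labelWeight σ' l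
labelWeight-mono star σ≤σ' = z≤n
labelWeight-mono (lbl i) σ≤σ' = σ≤σ' i

weight-mono : ∀ A {ρ ρ' σ σ'} → ρ ≤ₑ ρ' → σ ≤ₑ σ' → weight A ρ σ ≤ weight A ρ' σ'
weight-mono (var i) ρ≤ρ' σ≤σ' = ρ≤ρ' i
weight-mono (lam l A) ρ≤ρ' σ≤σ' =
  weight-mono A (∷ₑ-mono (labelWeight-mono l σ≤σ') ρ≤ρ') σ≤σ'
weight-mono (app A B) ρ≤ρ' σ≤σ' =
  +-mono-≤ (weight-mono A ρ≤ρ' (∷ₑ-mono B≤B' σ≤σ')) (s≤s B≤B')
  where B≤B' = weight-mono B ρ≤ρ' σ≤σ'

weight-vshift : ∀ B c w ρ σ → weight (vshift c B) (insert c w ρ) σ ≡ weight B ρ σ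
weight-vshift (var i) c w ρ σ =
  trans (if-float (λ t → weight t (insert c w ρ) σ) (i <ᵇ c)) (insert-lookup-shifted c w ρ i)
weight-vshift (lam l B) c w ρ σ = weight-vshift B (suc c) w (labelWeight σ l ∷ₑ ρ) σ
weight-vshift (app A B) c w ρ σ rewrite weight-vshift B c w ρ σ =
  cong (_+ suc (weight B ρ σ)) (weight-vshift A c w ρ (weight B ρ σ ∷ₑ σ))

labelWeight-lshiftLab : ∀ c w σ l →
  labelWeight (insert c w σ) (lshiftLab c l) ≡ labelWeight σ l
labelWeight-lshiftLab c w σ star = refl
labelWeight-lshiftLab c w σ (lbl i) =
  trans (if-float (labelWeight (insert c w σ)) (i <ᵇ c)) (insert-lookup-shifted c w σ i)

weight-lshift : ∀ B c w ρ σ → weight (lshift c B) ρ (insert c w σ) ≡ weight B ρ σ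
weight-lshift (var i) c w ρ σ = refl
weight-lshift (lam l B) c w ρ σ rewrite labelWeight-lshiftLab c w σ l =
  weight-lshift B c w (labelWeight σ l ∷ₑ ρ) σ
weight-lshift (app A B) c w ρ σ rewrite weight-lshift B c w ρ σ =
  cong (_+ suc (weight B ρ σ)) (weight-lshift A (suc c) w ρ (weight B ρ σ ∷ₑ σ))

labelWeight-lstarLab : ∀ c w σ l → labelWeight σ (lstarLab c l) ≤ labelWeight (insert c w σ) l
labelWeight-lstarLab c w σ star = z≤n
labelWeight-lstarLab c w σ (lbl i) rewrite insert-lookup c w σ i with i <ᵇ c
... | true = ≤-refl
... | false with i ≡ᵇ c
...   | true = z≤n
...   | false = ≤-refl

weight-lstar : ∀ A c w ρ σ → weight (lstar c A) ρ σ ≤ weight A ρ (insert c w σ)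
weight-lstar (var i) c w ρ σ = ≤-refl
weight-lstar (lam l A) c w ρ σ =
  ≤-trans (weight-mono (lstar c A) (∷ₑ-mono (labelWeight-lstarLab c w σ l) ≤ₑ-refl) ≤ₑ-refl)
          (weight-lstar A c w (labelWeight (insert c w σ) l ∷ₑ ρ) σ)
weight-lstar (app A B) c w ρ σ =
  +-mono-≤ (≤-trans (weight-lstar A (suc c) w ρ (weight (lstar c B) ρ σ ∷ₑ σ))
                    (weight-mono A ≤ₑ-refl (∷ₑ-mono B* ≤ₑ-refl)))
           (s≤s B*)
  where B* = weight-lstar B c w ρ σ

weight-subst : ∀ A j B ρ σ → weight (subst j B A) ρ σ ≡ weight A (insert j (weight B ρ σ) ρ) σ
weight-subst (var i) j B ρ σ rewrite insert-lookup j (weight B ρ σ) ρ i with i <ᵇ j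
... | true = refl
... | false with i ≡ᵇ j
...   | true = refl
...   | false = refl
weight-subst (lam l A) j B ρ σ
  rewrite weight-subst A (suc j) (vshift 0 B) (labelWeight σ l ∷ₑ ρ) σ
        | weight-vshift B 0 (labelWeight σ l) ρ σ = refl
weight-subst (app A₁ A₂) j B ρ σ
  rewrite weight-subst A₂ j B ρ σ
        | weight-subst A₁ j (lshift 0 B) ρ (weight A₂ (insert j (weight B ρ σ) ρ) σ ∷ₑ σ)
        | weight-lshift B 0 (weight A₂ (insert j (weight B ρ σ) ρ) σ) ρ σ = refl

weight-contract : ∀ A B ρ σ →
  weight (contract A B) ρ σ < weight (app (lam (lbl 0) A) B) ρ σ
weight-contract A B ρ σ rewrite weight-subst (lstar 0 A) 0 B ρ σ =
  ≤-<-trans (weight-lstar A 0 w (w ∷ₑ ρ) σ) (m<m+n _ (s≤s z≤n))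
  where w = weight B ρ σ

StepW-weight-< : ∀ {k A A'} → StepW k A A' → ∀ ρ σ → weight A' ρ σ < weight A ρ σ
StepW-weight-< (β {A} {B} _) ρ σ = weight-contract A B ρ σ
StepW-weight-< (ξ-lam {l} s) ρ σ = StepW-weight-< s (labelWeight σ l ∷ₑ ρ) σ
StepW-weight-< (ξ-appl {B = B} s) ρ σ =
  +-monoˡ-< (suc (weight B ρ σ)) (StepW-weight-< s ρ (weight B ρ σ ∷ₑ σ))
StepW-weight-< (ξ-appr {A} s) ρ σ =
  +-mono-≤-< (weight-mono A ≤ₑ-refl (∷ₑ-mono (<⇒≤ B'<B) ≤ₑ-refl)) (s≤s B'<B)
  where B'<B = StepW-weight-< s ρ σ

closedWeight : Tm → ℕ
closedWeight A = weight A (λ _ → 0) (λ _ → 0)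

infiniteWSeq-descent : Descent (_<_ on closedWeight) InfiniteWSeq
infiniteWSeq-descent (f , refl , steps) =
  f 1 , StepW-weight-< (steps 0) _ _ , (f ∘ suc , refl , steps ∘ suc)

mainTheorem3 : (A : Tm) → InitiallyLabeled A → ¬ InfiniteWSeq A
mainTheorem3 A _ =
  descent∧wf⇒empty infiniteWSeq-descent (On.wellFounded closedWeight <-wellFounded) A
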